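{- Let $\Omega$ be a set, $\Pi$ a monoid with involution of similarities on $\Omega$, $\approx$ the relation $\approx_\Pi$, and $\pi\in\Pi$. Then: (1) $\pi/\approx$ is a permutation of $\Omega/\approx$; (2) if $R$ is invariant under $\approx$ then $R\,\pi\,S$, where $S=\pi(R)$; (3) if moreover $\approx_\Pi\in\Pi$, $\bar a,\bar b\in\Omega^\alpha$ ($\alpha$ an ordinal), $\bar a\,\pi\,\bar b$, and $\varphi(\bar x)$ is a formula of $\mathscr{L}^-_{\infty\infty}(\mathrm{Inv}(\Pi))$, then $\Omega,\mathrm{Inv}(\Pi)\models\varphi(\bar a)\leftrightarrow\varphi(\bar b)$.
   Context: A similarity on $\Omega$ is $\pi\subseteq\Omega\times\Omega$ such that every $a$ has some $b$ with $a\,\pi\,b$ and every $b$ has some $a$ with $a\,\pi\,b$; on tuples componentwise. A set of similarities is a monoid with involution if closed under relational composition and converse. $a\approx_\Pi b$ iff for every finite tuple $\bar c$ there is $\pi\in\Pi$ with $(a,\bar c)\,\pi\,(b,\bar c)$. For $R,S\subseteq\Omega^k$, $R\,\pi\,S$ means: for all $\bar a\,\pi\,\bar b$, $\bar a\in R$ iff $\bar b\in S$ (componentwise for tuples of relations); $\pi(R)=\{\bar b:\exists\bar a\in R,\ \bar a\,\pi\,\bar b\}$; $R$ is invariant under $\pi$ if $R\,\pi\,R$; $R$ is invariant under an equivalence $\sim$ if $\bar a\in R$, $\bar a\sim\bar b$ (componentwise) imply $\bar b\in R$. A quantifier of type $(k_1,\dots,k_l)$ on $\Omega$ is a subset of $\mathcal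 P(\Omega^{k_1})\times\dots\times\mathcal P(\Omega^{k_l})$; it is $\sim$-invariant under $\pi$ if for all $\bar R,\bar S$ of its type with all components invariant under $\sim$ and $\bar R\,\pi\,\bar S$: $\bar R\in Q$ iff $\bar S\in Q$; a first-order relation (subset of $\Omega^k$, $k$ finite) is $\sim$-invariant under $\pi$ iff invariant under $\pi$. $\mathrm{Inv}(\Pi)$ is the set of first-order relations and quantifiers on $\Omega$ that are $\approx_\Pi$-invariant under every $\pi\in\Pi$. For a set $q$ of relations and quantifiers, $\mathscr{L}^-_{\infty\infty}(q)$ is the equality-free infinitary logic (arbitrary conjunctions/disjunctions, quantification over arbitrarily long sequences of variables, no equality) with a predicate symbol for each relation of $q$ and a generalized quantifier symbol for each $Q\in q$, where $Q\bar x_1\dots\bar x_l(\varphi_1,\dots,\varphi_l)$ holds iff $(\|\varphi_1\|,\dots,\|\varphi_l\|)\in Q$, $\|\varphi_i\|$ the set of $k_i$-tuples satisfying $\varphi_i$ in the bound variables $\bar x_i$. $\Omega/\approx$ is the set of classes $[a]$ and $\pi/\approx=\{([a],[b]):a\,\pi\,b\}$. -}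

module Defs where

open import Data.Nat using (ℕ)
open import Data.Fin using (Fin)
open import Data.Product using (Σ; ∃; _×_; _,_)
open import Data.Sum using (_⊎_; [_,_])
open import Function.Bundles using (_⇔_)
open import Relation.Nullary using (¬_)
open import Level using (Lift; suc; zero)

HRel : Set → Set₁
HRel Ω = Ω → Ω → Set

IsSimilarity : {Ω : Set} → HRel Ω → Set
IsSimilarity {Ω} π = (∀ a → ∃ λ b → π a b) × (∀ b → ∃ λ a → π a b)

_⨾_ : {Ω : Set} → HRel Ω → HRel Ω → HRel Ω
(π ⨾ ρ) a c = ∃ λ b → π a b × ρ b c

converse : {Ω : Set} → HRel Ω → HRel Ω
converse π a b = π b a

SameRel : {Ω : Set} → HRel Ω → HRel Ω → Set
SameRel π ρ = ∀ a b → π a b ⇔ ρ a b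

-- Π = { sim i : i ∈ I } is a set of similarities closed under composition and converse
record MonoidWithInvolution (Ω : Set) (I : Set) (sim : I → HRel Ω) : Set₁ where
  field
    similarity  : ∀ i → IsSimilarity (sim i)
    comp-closed : ∀ i j → ∃ λ k → SameRel (sim k) (sim i ⨾ sim j)
    conv-closed : ∀ i → ∃ λ j → SameRel (sim j) (converse (sim i))

TupRel : {Ω A : Set} → HRel Ω → (A → Ω) → (A → Ω) → Set
TupRel π a b = ∀ x → π (a x) (b x)

Approx : {Ω I : Set} → (I → HRel Ω) → HRel Ω
Approx {Ω} {I} sim a b =
  (n : ℕ) (c : Fin n → Ω) → ∃ λ i → sim i a b × TupRel (sim i) c c

-- π/≈ on Ω/≈, represented on representatives: [a] (π/≈) [b]
QuotRel : {Ω : Set} → HRel Ω → HRel Ω → HRel Ω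
QuotRel ≈ π a b = ∃ λ a' → ∃ λ b' → ≈ a a' × ≈ b b' × π a' b'

record IsPermutationMod {Ω : Set} (≈ : HRel Ω) (ρ : HRel Ω) : Set where
  field
    total      : ∀ a → ∃ λ b → ρ a b
    functional : ∀ a b b' → ρ a b → ρ a b' → ≈ b b'
    injective  : ∀ a a' b → ρ a b → ρ a' b → ≈ a a'
    surjective : ∀ b → ∃ λ a → ρ a b

FRel : Set → ℕ → Set₁
FRel Ω k = (Fin k → Ω) → Set

RelRel : {Ω : Set} {k : ℕ} → HRel Ω → FRel Ω k → FRel Ω k → Set
RelRel π R S = ∀ a b → TupRel π a b → (R a ⇔ S b)

image : {Ω : Set} {k : ℕ} → HRel Ω → FRel Ω k → FRel Ω k
image π R b = ∃ λ a → R a × TupRel π a b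

InvariantUnder : {Ω : Set} {k : ℕ} → HRel Ω → FRel Ω k → Set
InvariantUnder π R = RelRel π R R

InvariantEq : {Ω : Set} {k : ℕ} → HRel Ω → FRel Ω k → Set
InvariantEq ∼ R = ∀ a b → R a → TupRel ∼ a b → R b

Quant : Set → (l : ℕ) → (Fin l → ℕ) → Set₁
Quant Ω l ks = ((i : Fin l) → FRel Ω (ks i)) → Set

QInv : {Ω : Set} {l : ℕ} {ks : Fin l → ℕ} → HRel Ω → HRel Ω → Quant Ω l ks → Set₁
QInv {Ω} {l} {ks} ∼ π Q =
  (R S : (i : Fin l) → FRel Ω (ks i)) →
  (∀ i → InvariantEq ∼ (R i)) → (∀ i → InvariantEq ∼ (S i)) →
  (∀ i → RelRel π (R i) (S i)) → (Q R ⇔ Q S)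

InvRel : {Ω I : Set} → (I → HRel Ω) → (k : ℕ) → FRel Ω k → Set₁
InvRel sim k R = Lift (suc zero) (∀ i → InvariantUnder (sim i) R)

InvQuant : {Ω I : Set} → (I → HRel Ω) → (l : ℕ) (ks : Fin l → ℕ) → Quant Ω l ks → Set₁
InvQuant sim l ks Q = ∀ i → QInv (Approx sim) (sim i) Q

-- Equality-free infinitary logic L⁻_{∞∞}(q), q given by the predicates RS (relations)
-- and QS (quantifiers); formulas indexed by their set of free variables V.
data Formula {Ω : Set}
    (RS : (k : ℕ) → FRel Ω k → Set₁)
    (QS : (l : ℕ) (ks : Fin l → ℕ) → Quant Ω l ks → Set₁) : Set → Set₁ where
  rel  : ∀ {V} (k : ℕ) (R : FRel Ω k) → RS k R → (Fin k → V) → Formula RS QS V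
  neg  : ∀ {V} → Formula RS QS V → Formula RS QS V
  conj : ∀ {V} (J : Set) → (J → Formula RS QS V) → Formula RS QS V
  disj : ∀ {V} (J : Set) → (J → Formula RS QS V) → Formula RS QS V
  ex   : ∀ {V} (W : Set) → Formula RS QS (V ⊎ W) → Formula RS QS V
  all  : ∀ {V} (W : Set) → Formula RS QS (V ⊎ W) → Formula RS QS V
  gq   : ∀ {V} (l : ℕ) (ks : Fin l → ℕ) (Q : Quant Ω l ks) → QS l ks Q →
         ((i : Fin l) → Formula RS QS (V ⊎ Fin (ks i))) → Formula RS QS V

Sat : {Ω : Set} {RS : (k : ℕ) → FRel Ω k → Set₁}
      {QS : (l : ℕ) (ks : Fin l → ℕ) → Quant Ω l ks → Set₁} {V : Set} →
      Formula RS QS V → (V → Ω) → Set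
Sat (rel k R _ xs) ρ = R (λ j → ρ (xs j))
Sat (neg φ) ρ = ¬ Sat φ ρ
Sat (conj J φ) ρ = (j : J) → Sat (φ j) ρ
Sat (disj J φ) ρ = Σ J λ j → Sat (φ j) ρ
Sat (ex W φ) ρ = Σ (W → _) λ w → Sat φ [ ρ , w ]
Sat (all W φ) ρ = (w : W → _) → Sat φ [ ρ , w ]
Sat (gq l ks Q _ φ) ρ = Q (λ i t → Sat (φ i) [ ρ , t ])

-- Each π ∈ Π respects ≈: if a π b and a' π b' with a ≈ a', then for any tuple c̄
-- choose a π-preimage d̄ of c̄ and τ ∈ Π with (a, d̄) τ (a', d̄); then π⁻¹ τ π ∈ Π
-- witnesses (b, c̄) ~ (b', c̄).  So π/≈ is a function, and applied to π⁻¹ it is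
-- injective.  Invariance of formulas is proved by induction, using the totality of
-- similarities for the quantifiers and, for generalised quantifiers, the fact that
-- the defining relations of a subformula are ≈-invariant because ≈ itself is in Π.
module Submission where

open import Defs
open import Data.Nat using (ℕ)
open import Data.Product using (∃; _×_; _,_; proj₁; proj₂)
open import Data.Sum using (inj₁; inj₂; [_,_])
open import Function.Bundles using (_⇔_; mk⇔; Equivalence)
open import Relation.Binary using (IsEquivalence)
open import Level using (lift)

tupRel-[,] : {Ω V W : Set} (π : HRel Ω) {a b : V → Ω} {c d : W → Ω} →
             TupRel π a b → TupRel π c d → TupRel π [ a , c ] [ b , d ]
tupRel-[,] _ ab cd (inj₁ v) = ab v
tupRel-[,] _ ab cd (inj₂ w) = cd w

module _ {Ω : Set} {π : HRel Ω} (simπ : IsSimilarity π) where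

  image-tuple : {W : Set} (c : W → Ω) → ∃ λ d → TupRel π c d
  image-tuple c = (λ w → proj₁ (proj₁ simπ (c w))) , λ w → proj₂ (proj₁ simπ (c w))

  preimage-tuple : {W : Set} (d : W → Ω) → ∃ λ c → TupRel π c d
  preimage-tuple d = (λ w → proj₁ (proj₂ simπ (d w))) , λ w → proj₂ (proj₂ simπ (d w))

module MonoidProperties {Ω I : Set} {sim : I → HRel Ω} (Π : MonoidWithInvolution Ω I sim) where
  open MonoidWithInvolution Π

  infix  8 _⁻¹
  infixl 7 _·_

  _⁻¹ : I → I
  i ⁻¹ = proj₁ (conv-closed i)

  _·_ : I → I → I
  i · j = proj₁ (comp-closed i j)

  sim-⁻¹ : ∀ {i a b} → sim i a b → sim (i ⁻¹) b a
  sim-⁻¹ {i} {a} {b} = Equivalence.from (proj₂ (conv-closed i) b a)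

  sim-· : ∀ {i j a b c} → sim i a b → sim j b c → sim (i · j) a c
  sim-· {i} {j} {a} {b} {c} p q = Equivalence.from (proj₂ (comp-closed i j) a c) (b , p , q)

  ·⁻¹-reflexive : ∀ i a → sim (i · i ⁻¹) a a
  ·⁻¹-reflexive i a = sim-· p (sim-⁻¹ p)
    where p = proj₂ (proj₁ (similarity i) a)

  _≈_ : HRel Ω
  _≈_ = Approx sim

  ≈-refl : I → ∀ {a} → a ≈ a
  ≈-refl i {a} n c = i · i ⁻¹ , ·⁻¹-reflexive i a , λ x → ·⁻¹-reflexive i (c x)

  ≈-sym : ∀ {a b} → a ≈ b → b ≈ a
  ≈-sym a≈b n c with a≈b n c
  ... | k , p , q = k ⁻¹ , sim-⁻¹ p , λ x → sim-⁻¹ (q x)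

  ≈-trans : ∀ {a b c} → a ≈ b → b ≈ c → a ≈ c
  ≈-trans a≈b b≈c n d with a≈b n d | b≈c n d
  ... | k , p , q | k' , p' , q' = k · k' , sim-· p p' , λ x → sim-· (q x) (q' x)

  ≈-isEquivalence : I → IsEquivalence _≈_
  ≈-isEquivalence i = record { refl = ≈-refl i ; sym = ≈-sym ; trans = ≈-trans }

  sim-resp-≈ : ∀ i {a b a' b'} → sim i a b → sim i a' b' → a ≈ a' → b ≈ b'
  sim-resp-≈ i {a} {b} {a'} {b'} ab a'b' a≈a' n c
    with preimage-tuple (similarity i) c
  ... | d , dc with a≈a' n d
  ... | τ , aτa' , dτd =
    i ⁻¹ · (τ · i) , sim-· (sim-⁻¹ ab) (sim-· aτa' a'b') ,
    λ x → sim-· (sim-⁻¹ (dc x)) (sim-· (dτd x) (dc x))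

  sim-injective-≈ : ∀ i {a a' b} → sim i a b → sim i a' b → a ≈ a'
  sim-injective-≈ i ab a'b = sim-resp-≈ (i ⁻¹) (sim-⁻¹ ab) (sim-⁻¹ a'b) (≈-refl i)

  module _ (i : I) where

    sim⇒quot : ∀ {a b} → sim i a b → QuotRel _≈_ (sim i) a b
    sim⇒quot {a} {b} ab = a , b , ≈-refl i , ≈-refl i , ab

    quot-functional : ∀ {a b b'} → QuotRel _≈_ (sim i) a b → QuotRel _≈_ (sim i) a b' → b ≈ b'
    quot-functional (a₁ , b₁ , a≈a₁ , b≈b₁ , p₁) (a₂ , b₂ , a≈a₂ , b'≈b₂ , p₂) =
      ≈-trans b≈b₁ (≈-trans (sim-resp-≈ i p₁ p₂ (≈-trans (≈-sym a≈a₁) a≈a₂)) (≈-sym b'≈b₂))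

  quot-⁻¹ : ∀ i {a b} → QuotRel _≈_ (sim i) a b → QuotRel _≈_ (sim (i ⁻¹)) b a
  quot-⁻¹ i (a' , b' , a≈a' , b≈b' , p) = b' , a' , b≈b' , a≈a' , sim-⁻¹ p

  quot-isPermutation : ∀ i → IsPermutationMod _≈_ (QuotRel _≈_ (sim i))
  quot-isPermutation i = record
    { total      = λ a → let (b , ab) = proj₁ (similarity i) a in b , sim⇒quot i ab
    ; functional = λ _ _ _ → quot-functional i
    ; injective  = λ _ _ _ p q → quot-functional (i ⁻¹) (quot-⁻¹ i p) (quot-⁻¹ i q)
    ; surjective = λ b → let (a , ab) = proj₂ (similarity i) b in a , sim⇒quot i ab
    }

  ≈-invariant⇒relates-image : ∀ i {k} (R : FRel Ω k) → InvariantEq _≈_ R →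
                              RelRel (sim i) R (image (sim i) R)
  ≈-invariant⇒relates-image i R invR a b ab = mk⇔
    (λ Ra → a , Ra , ab)
    (λ { (a' , Ra' , a'b) → invR a' a Ra' (λ x → sim-injective-≈ i (a'b x) (ab x)) })

  module _ (j : I) (j≡≈ : SameRel (sim j) _≈_) where

    ≈⇒sim : ∀ {a b} → a ≈ b → sim j a b
    ≈⇒sim {a} {b} = Equivalence.from (j≡≈ a b)

    mutual
      sat-preserved : ∀ {V} (φ : Formula (InvRel sim) (InvQuant sim) V) i {a b : V → Ω} →
                      TupRel (sim i) a b → Sat φ a → Sat φ b
      sat-preserved (rel k R (lift invR) xs) i ab =
        Equivalence.to (invR i _ _ (λ y → ab (xs y)))
      sat-preserved (neg φ) i ab ¬φa φb = ¬φa (sat-preserved φ (i ⁻¹) (λ v → sim-⁻¹ (ab v)) φb)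
      sat-preserved (conj J φ) i ab φa k = sat-preserved (φ k) i ab (φa k)
      sat-preserved (disj J φ) i ab (k , φa) = k , sat-preserved (φ k) i ab φa
      sat-preserved (ex W φ) i ab (w , φa) =
        let (w' , ww') = image-tuple (similarity i) w
        in w' , sat-preserved φ i (tupRel-[,] (sim i) ab ww') φa
      sat-preserved (all W φ) i ab φa w' =
        let (w , ww') = preimage-tuple (similarity i) w'
        in sat-preserved φ i (tupRel-[,] (sim i) ab ww') (φa w)
      sat-preserved (gq l ks Q invQ φ) i {a} {b} ab = Equivalence.to
        (invQ i _ _ (defined-≈-invariant a) (defined-≈-invariant b)
          (λ k t t' tt' → sat-⇔ (φ k) i (tupRel-[,] (sim i) ab tt')))
        where
          defined-≈-invariant : ∀ c k → InvariantEq _≈_ (λ t → Sat (φ k) [ c , t ])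
          defined-≈-invariant c k t t' φct t≈t' =
            sat-preserved (φ k) j (tupRel-[,] (sim j) (λ v → ≈⇒sim (≈-refl i)) (λ x → ≈⇒sim (t≈t' x))) φct

      sat-⇔ : ∀ {V} (φ : Formula (InvRel sim) (InvQuant sim) V) i {a b : V → Ω} →
              TupRel (sim i) a b → Sat φ a ⇔ Sat φ b
      sat-⇔ φ i ab = mk⇔ (sat-preserved φ i ab) (sat-preserved φ (i ⁻¹) (λ v → sim-⁻¹ (ab v)))

lemma15 : (Ω I : Set) (sim : I → HRel Ω) → MonoidWithInvolution Ω I sim → (i : I) →
    (IsEquivalence (Approx sim) × IsPermutationMod (Approx sim) (QuotRel (Approx sim) (sim i)))
    × ((k : ℕ) (R : FRel Ω k) → InvariantEq (Approx sim) R → RelRel (sim i) R (image (sim i) R))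
    × ((∃ λ j → SameRel (sim j) (Approx sim)) →
       (V : Set) (a b : V → Ω) → TupRel (sim i) a b →
       (φ : Formula (InvRel sim) (InvQuant sim) V) → Sat φ a ⇔ Sat φ b)
lemma15 Ω I sim Π i =
  (≈-isEquivalence i , quot-isPermutation i) ,
  (λ k → ≈-invariant⇒relates-image i) ,
  λ { (j , j≡≈) V a b ab φ → sat-⇔ j j≡≈ φ i ab }
  where open MonoidProperties Π
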